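{- For all integers $0\le t\le j$, the sequence $b_n=L(j+n,t+n)$ ($n\ge0$) satisfies $b_n=\sum_{i=1}^k\lambda_ib_{n-i}$ for all $n\ge k$; that is, it satisfies the recurrence of $a$ with its first $k$ terms as initial conditions.
   Context: Fix nonnegative integers $\lambda_1,\lambda_2,\dots$ and an integer $k\ge1$ (the order) such that $\lambda_1\ge1$, $\lambda_k\ge1$, $\lambda_i=0$ for $i>k$, and $\lambda_1\ge2$ if $k=1$; the recurrence $a$ is $a_n=\sum_{i=1}^k\lambda_ia_{n-i}$. Let $\Lambda_j=\sum_{i=1}^j\lambda_i$. Finite ordered trees $T_j$: $T_0$ is a single node; for $j\ge1$, $T_j$ has a chain of special nodes $s_j$ (root), $s_{j-1},\dots,s_0$ with $s_i$ on level $i$ and $s_{i-1}$ the leftmost child of $s_i$, and $s_i$ ($1\le i\le j$) has $\Lambda_{j-i+1}$ children: $s_{i-1}$ followed by $\Lambda_{j-i+1}-1$ roots of copies of $T_{i-1}$. For $0\le t\le j$, $L(j,t)$ denotes the number of leaves of $T_j$ that descend from (or equal) its special node $s_t$ on level $t$. -}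

module Defs where

open import Data.Nat using (ℕ; zero; suc; _+_; _*_; _∸_; _≤_; _<_)
open import Data.List using (List; []; _∷_; replicate)
open import Relation.Binary.PropositionalEquality using (_≡_)

-- Λ_j = λ_1 + ... + λ_j  (the coefficient sequence is indexed from 1; λ 0 is ignored)
Λ : (ℕ → ℕ) → ℕ → ℕ
Λ lam zero    = 0
Λ lam (suc j) = Λ lam j + lam (suc j)

sum1 : ℕ → (ℕ → ℕ) → ℕ
sum1 zero    f = 0
sum1 (suc k) f = sum1 k f + f (suc k)

data Tree : Set where
  node : List Tree → Tree

mutual
  leaves : Tree → ℕ
  leaves (node []) = 1
  leaves (node (c ∷ cs)) = leaves c + leavesList cs

  leavesList : List Tree → ℕ
  leavesList []       = 0
  leavesList (c ∷ cs) = leaves c + leavesList cs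

-- Sub lam i d : the subtree rooted at the special node s_i of T_{i+d}
-- (i = level of the special node, d = j - i).  s_0 is a leaf; for i ≥ 1, s_i has
-- Λ_{j-i+1} = Λ_{d+1} children: s_{i-1} (of T_j, i.e. offset d+1) followed by
-- Λ_{d+1} - 1 copies of T_{i-1}.
Sub : (ℕ → ℕ) → ℕ → ℕ → Tree
Sub lam zero    d = node []
Sub lam (suc i) d = node (Sub lam i (suc d) ∷ replicate (Λ lam (suc d) ∸ 1) (Sub lam i 0))

T : (ℕ → ℕ) → ℕ → Tree
T lam j = Sub lam j 0

-- leftmost child (a leaf is sent to itself; never used on leaves below)
leftmost : Tree → Tree
leftmost (node [])      = node []
leftmost (node (c ∷ _)) = c

iter : ℕ → (Tree → Tree) → Tree → Tree
iter zero    f x = x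
iter (suc n) f x = f (iter n f x)

-- L(j,t): number of leaves of T_j descending from (or equal to) the special node
-- s_t on level t, reached from the root s_j by j - t leftmost-child steps.
L : (ℕ → ℕ) → ℕ → ℕ → ℕ
L lam j t = leaves (iter (j ∸ t) leftmost (T lam j))

record ValidRec (lam : ℕ → ℕ) (k : ℕ) : Set where
  field
    k≥1     : 1 ≤ k
    lam1≥1  : 1 ≤ lam 1
    lamk≥1  : 1 ≤ lam k
    lam-vanish : ∀ i → k < i → lam i ≡ 0
    k1⇒lam1≥2 : k ≡ 1 → 2 ≤ lam 1

-- Write S(i, d) for the number of leaves below the special node s_i of T_{i+d}.
-- Since s_i has s_{i-1} (of the same tree) and Λ_{d+1} - 1 copies of T_{i-1} as
-- children, S(i+1, d) = S(i, d+1) + (Λ_{d+1} - 1) S(i, 0). By induction on i this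
-- gives S(i+1, d) = Σ_{r=1}^{i+1} λ_r S(i+1-r, d) + (Λ_{i+1+d} - Λ_{i+1}), and the
-- defect vanishes as soon as i+1 ≥ k, because then Λ is constant from i+1 on.
-- Finally L(j+n, t+n) = S(t+n, j-t), so shifting by n only moves along the first
-- argument of S.
module Submission where

open import Defs
open import Data.Nat using (ℕ; zero; suc; _+_; _*_; _∸_; _≤_; _<_; s≤s; _≤′_; ≤′-step; ≤′-reflexive)
open import Data.Nat.Properties
open import Data.Nat.Tactic.RingSolver using (solve-∀)
open import Data.List using (replicate)
open import Data.Empty using (⊥-elim)
open import Relation.Binary.PropositionalEquality
open ≡-Reasoning

sum1-cong : ∀ n {f g : ℕ → ℕ} → (∀ r → r ≤ n → f r ≡ g r) → sum1 n f ≡ sum1 n g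
sum1-cong zero    f≗g = refl
sum1-cong (suc n) f≗g =
  cong₂ _+_ (sum1-cong n (λ r r≤n → f≗g r (m≤n⇒m≤1+n r≤n))) (f≗g (suc n) ≤-refl)

sum1-distrib-+ : ∀ n (f g : ℕ → ℕ) → sum1 n (λ r → f r + g r) ≡ sum1 n f + sum1 n g
sum1-distrib-+ zero    f g = refl
sum1-distrib-+ (suc n) f g = begin
  sum1 n (λ r → f r + g r) + (f (suc n) + g (suc n))
    ≡⟨ cong (_+ (f (suc n) + g (suc n))) (sum1-distrib-+ n f g) ⟩
  sum1 n f + sum1 n g + (f (suc n) + g (suc n))
    ≡⟨ interchange (sum1 n f) (sum1 n g) (f (suc n)) (g (suc n)) ⟩
  sum1 n f + f (suc n) + (sum1 n g + g (suc n)) ∎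
  where
  interchange : ∀ a b c d → a + b + (c + d) ≡ a + c + (b + d)
  interchange = solve-∀

sum1-*-distribˡ : ∀ n a (f : ℕ → ℕ) → sum1 n (λ r → a * f r) ≡ a * sum1 n f
sum1-*-distribˡ zero    a f = sym (*-zeroʳ a)
sum1-*-distribˡ (suc n) a f =
  trans (cong (_+ a * f (suc n)) (sum1-*-distribˡ n a f))
        (sym (*-distribˡ-+ a (sum1 n f) (f (suc n))))

sum1-vanishing-tail : ∀ {k n} (f : ℕ → ℕ) → (∀ r → k < r → f r ≡ 0) →
                      k ≤′ n → sum1 n f ≡ sum1 k f
sum1-vanishing-tail f f>k≡0 (≤′-reflexive refl) = refl
sum1-vanishing-tail {k} {suc n} f f>k≡0 (≤′-step k≤n) = begin
  sum1 n f + f (suc n) ≡⟨ cong (sum1 n f +_) (f>k≡0 (suc n) (s≤s (≤′⇒≤ k≤n))) ⟩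
  sum1 n f + 0         ≡⟨ +-identityʳ (sum1 n f) ⟩
  sum1 n f             ≡⟨ sum1-vanishing-tail f f>k≡0 k≤n ⟩
  sum1 k f             ∎

Λ-positive : ∀ {lam} → 1 ≤ lam 1 → ∀ d → 1 ≤ Λ lam (suc d)
Λ-positive lam1≥1 zero    = lam1≥1
Λ-positive lam1≥1 (suc d) = ≤-trans (Λ-positive lam1≥1 d) (m≤m+n _ _)

Λ-constant : ∀ {lam k} → (∀ i → k < i → lam i ≡ 0) →
             ∀ m d → k ≤ m → Λ lam (m + d) ≡ Λ lam m
Λ-constant {lam} lam>k≡0 m zero    k≤m = cong (Λ lam) (+-identityʳ m)
Λ-constant {lam} lam>k≡0 m (suc d) k≤m = begin
  Λ lam (m + suc d)                      ≡⟨ cong (Λ lam) (+-suc m d) ⟩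
  Λ lam (m + d) + lam (suc (m + d))      ≡⟨ cong (Λ lam (m + d) +_) (lam>k≡0 _ k<1+m+d) ⟩
  Λ lam (m + d) + 0                      ≡⟨ +-identityʳ _ ⟩
  Λ lam (m + d)                          ≡⟨ Λ-constant lam>k≡0 m d k≤m ⟩
  Λ lam m                                ∎
  where
  k<1+m+d = s≤s (≤-trans k≤m (m≤m+n m d))

leavesList-replicate : ∀ m x → leavesList (replicate m x) ≡ m * leaves x
leavesList-replicate zero    x = refl
leavesList-replicate (suc m) x = cong (leaves x +_) (leavesList-replicate m x)

iter-leftmost-Sub : ∀ lam m i d → iter m leftmost (Sub lam (m + i) d) ≡ Sub lam i (m + d)
iter-leftmost-Sub lam zero    i d = refl
iter-leftmost-Sub lam (suc m) i d = begin
  leftmost (iter m leftmost (Sub lam (suc m + i) d))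
    ≡⟨ cong (λ x → leftmost (iter m leftmost (Sub lam x d))) (sym (+-suc m i)) ⟩
  leftmost (iter m leftmost (Sub lam (m + suc i) d))
    ≡⟨ cong leftmost (iter-leftmost-Sub lam m (suc i) d) ⟩
  Sub lam i (suc m + d) ∎

module _ (lam : ℕ → ℕ) where

  leavesSub : ℕ → ℕ → ℕ
  leavesSub i d = leaves (Sub lam i d)

  L≡leavesSub : ∀ {j t} → t ≤ j → L lam j t ≡ leavesSub t (j ∸ t)
  L≡leavesSub {j} {t} t≤j = begin
    leaves (iter (j ∸ t) leftmost (Sub lam j 0))
      ≡⟨ cong (λ x → leaves (iter (j ∸ t) leftmost (Sub lam x 0))) (sym (m∸n+n≡m t≤j)) ⟩
    leaves (iter (j ∸ t) leftmost (Sub lam ((j ∸ t) + t) 0))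
      ≡⟨ cong leaves (iter-leftmost-Sub lam (j ∸ t) t 0) ⟩
    leavesSub t ((j ∸ t) + 0)
      ≡⟨ cong (leavesSub t) (+-identityʳ (j ∸ t)) ⟩
    leavesSub t (j ∸ t) ∎

  L-shift : ∀ {j t} m → t ≤ j → L lam (j + m) (t + m) ≡ leavesSub (t + m) (j ∸ t)
  L-shift {j} {t} m t≤j = begin
    L lam (j + m) (t + m)                   ≡⟨ L≡leavesSub (+-monoˡ-≤ m t≤j) ⟩
    leavesSub (t + m) ((j + m) ∸ (t + m))   ≡⟨ cong (leavesSub (t + m)) offset ⟩
    leavesSub (t + m) (j ∸ t)               ∎
    where
    offset : (j + m) ∸ (t + m) ≡ j ∸ t
    offset rewrite +-comm j m | +-comm t m = [m+n]∸[m+o]≡n∸o m j t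

  copies : ℕ → ℕ
  copies d = Λ lam (suc d) ∸ 1

  leavesSub-suc : ∀ i d → leavesSub (suc i) d ≡ leavesSub i (suc d) + copies d * leavesSub i 0
  leavesSub-suc i d = cong (leavesSub i (suc d) +_) (leavesList-replicate (copies d) (Sub lam i 0))

  recSum : ℕ → ℕ → ℕ
  recSum i d = sum1 i (λ r → lam r * leavesSub (i ∸ r) d)

  recSum-suc : ∀ i d →
    recSum (suc (suc i)) d ≡ recSum (suc i) (suc d) + copies d * recSum (suc i) 0 + lam (suc (suc i))
  recSum-suc i d = begin
    recSum (suc (suc i)) d
      ≡⟨ cong₂ _+_ (sum1-cong (suc i) term) last ⟩
    sum1 (suc i) (λ r → lam r * leavesSub (suc i ∸ r) (suc d)
                        + copies d * (lam r * leavesSub (suc i ∸ r) 0)) + lam (suc (suc i))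
      ≡⟨ cong (_+ lam (suc (suc i))) (sum1-distrib-+ (suc i) _ _) ⟩
    recSum (suc i) (suc d) + sum1 (suc i) (λ r → copies d * (lam r * leavesSub (suc i ∸ r) 0))
      + lam (suc (suc i))
      ≡⟨ cong (λ x → recSum (suc i) (suc d) + x + lam (suc (suc i))) (sum1-*-distribˡ (suc i) (copies d) _) ⟩
    recSum (suc i) (suc d) + copies d * recSum (suc i) 0 + lam (suc (suc i)) ∎
    where
    distrib : ∀ l a b x → l * (a + x * b) ≡ l * a + x * (l * b)
    distrib = solve-∀
    term : ∀ r → r ≤ suc i → lam r * leavesSub (suc (suc i) ∸ r) d
         ≡ lam r * leavesSub (suc i ∸ r) (suc d) + copies d * (lam r * leavesSub (suc i ∸ r) 0)
    term r r≤1+i rewrite +-∸-assoc 1 r≤1+i =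
      trans (cong (lam r *_) (leavesSub-suc (suc i ∸ r) d)) (distrib (lam r) _ _ (copies d))
    last : lam (suc (suc i)) * leavesSub (suc (suc i) ∸ suc (suc i)) d ≡ lam (suc (suc i))
    last rewrite n∸n≡0 i = *-identityʳ _

  -- Stated additively, since Λ_{i+1+d} - Λ_{i+1} would need truncated subtraction.
  leavesSub-recSum-defect : 1 ≤ lam 1 → ∀ i d →
    leavesSub (suc i) d + Λ lam (suc i) ≡ recSum (suc i) d + Λ lam (suc i + d)
  leavesSub-recSum-defect lam1≥1 zero d = begin
    leavesSub 1 d + (0 + lam 1)      ≡⟨ cong (_+ (0 + lam 1)) (leavesSub-suc 0 d) ⟩
    suc (copies d * 1) + (0 + lam 1) ≡⟨ cong (λ x → suc x + (0 + lam 1)) (*-identityʳ (copies d)) ⟩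
    suc (copies d) + (0 + lam 1)     ≡⟨ cong (_+ (0 + lam 1)) (m+[n∸m]≡n (Λ-positive lam1≥1 d)) ⟩
    Λ lam (suc d) + lam 1            ≡⟨ +-comm (Λ lam (suc d)) (lam 1) ⟩
    lam 1 + Λ lam (suc d)            ≡⟨ cong (_+ Λ lam (suc d)) (sym (*-identityʳ (lam 1))) ⟩
    0 + lam 1 * 1 + Λ lam (suc d)    ∎
  leavesSub-recSum-defect lam1≥1 (suc i) d = begin
    leavesSub (suc (suc i)) d + Λ lam (suc (suc i))
      ≡⟨ cong (_+ Λ lam (suc (suc i))) (leavesSub-suc (suc i) d) ⟩
    leavesSub (suc i) (suc d) + copies d * leavesSub (suc i) 0 + (Λ lam (suc i) + lam (suc (suc i)))
      ≡⟨ cong (λ x → leavesSub (suc i) (suc d) + copies d * x + (Λ lam (suc i) + lam (suc (suc i))))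
              leavesT≡recSum ⟩
    leavesSub (suc i) (suc d) + copies d * recSum (suc i) 0 + (Λ lam (suc i) + lam (suc (suc i)))
      ≡⟨ regroup₁ (leavesSub (suc i) (suc d)) _ _ _ ⟩
    leavesSub (suc i) (suc d) + Λ lam (suc i) + copies d * recSum (suc i) 0 + lam (suc (suc i))
      ≡⟨ cong (λ x → x + copies d * recSum (suc i) 0 + lam (suc (suc i)))
              (leavesSub-recSum-defect lam1≥1 i (suc d)) ⟩
    recSum (suc i) (suc d) + Λ lam (suc i + suc d) + copies d * recSum (suc i) 0 + lam (suc (suc i))
      ≡⟨ regroup₂ (recSum (suc i) (suc d)) _ _ _ ⟩
    recSum (suc i) (suc d) + copies d * recSum (suc i) 0 + lam (suc (suc i)) + Λ lam (suc i + suc d)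
      ≡⟨ cong₂ _+_ (sym (recSum-suc i d)) (cong (Λ lam) (+-suc (suc i) d)) ⟩
    recSum (suc (suc i)) d + Λ lam (suc (suc i) + d) ∎
    where
    -- For d = 0 the defect is zero: the leaf counts of the trees T_i obey the recurrence.
    leavesT≡recSum : leavesSub (suc i) 0 ≡ recSum (suc i) 0
    leavesT≡recSum = +-cancelʳ-≡ (Λ lam (suc i)) _ _
      (trans (leavesSub-recSum-defect lam1≥1 i 0)
             (cong (λ x → recSum (suc i) 0 + Λ lam x) (+-identityʳ (suc i))))
    regroup₁ : ∀ a x b l → a + x + (b + l) ≡ a + b + x + l
    regroup₁ = solve-∀
    regroup₂ : ∀ a z x l → a + z + x + l ≡ a + x + l + z
    regroup₂ = solve-∀

  leavesSub-recurrence : ∀ {k} → ValidRec lam k → ∀ i d → k ≤ i →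
    leavesSub i d ≡ sum1 k (λ r → lam r * leavesSub (i ∸ r) d)
  leavesSub-recurrence v zero    d k≤0 = ⊥-elim (1+n≰n (≤-trans (ValidRec.k≥1 v) k≤0))
  leavesSub-recurrence {k} v (suc i) d k≤1+i = begin
    leavesSub (suc i) d  ≡⟨ +-cancelʳ-≡ (Λ lam (suc i)) _ _ defect-vanishes ⟩
    recSum (suc i) d     ≡⟨ sum1-vanishing-tail _ tail≡0 (≤⇒≤′ k≤1+i) ⟩
    sum1 k (λ r → lam r * leavesSub (suc i ∸ r) d) ∎
    where
    open ValidRec v
    defect-vanishes : leavesSub (suc i) d + Λ lam (suc i) ≡ recSum (suc i) d + Λ lam (suc i)
    defect-vanishes = trans (leavesSub-recSum-defect lam1≥1 i d)
                            (cong (recSum (suc i) d +_) (Λ-constant lam-vanish (suc i) d k≤1+i))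
    tail≡0 : ∀ r → k < r → lam r * leavesSub (suc i ∸ r) d ≡ 0
    tail≡0 r k<r = cong (_* leavesSub (suc i ∸ r) d) (lam-vanish r k<r)

corollary4p16 : (lam : ℕ → ℕ) (k : ℕ) → ValidRec lam k →
    (j t : ℕ) → t ≤ j →
    (n : ℕ) → k ≤ n →
    L lam (j + n) (t + n) ≡ sum1 k (λ i → lam i * L lam (j + (n ∸ i)) (t + (n ∸ i)))
corollary4p16 lam k v j t t≤j n k≤n = begin
  L lam (j + n) (t + n)
    ≡⟨ L-shift lam n t≤j ⟩
  leavesSub lam (t + n) (j ∸ t)
    ≡⟨ leavesSub-recurrence lam v (t + n) (j ∸ t) (≤-trans k≤n (m≤n+m n t)) ⟩
  sum1 k (λ r → lam r * leavesSub lam (t + n ∸ r) (j ∸ t))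
    ≡⟨ sum1-cong k (λ r r≤k → cong (lam r *_) (shifted-term r (≤-trans r≤k k≤n))) ⟩
  sum1 k (λ r → lam r * L lam (j + (n ∸ r)) (t + (n ∸ r))) ∎
  where
  shifted-term : ∀ r → r ≤ n → leavesSub lam (t + n ∸ r) (j ∸ t) ≡ L lam (j + (n ∸ r)) (t + (n ∸ r))
  shifted-term r r≤n = trans (cong (λ x → leavesSub lam x (j ∸ t)) (+-∸-assoc t r≤n))
                             (sym (L-shift lam (n ∸ r) t≤j))
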